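{- Let $(G,k)$ be an instance of CTVD and let $P = (v_1, v_2, \dots, v_\ell)$ be a path in $G$ such that $d_G(v_1) > 2$, $d_G(v_\ell) = 1$, and $d_G(v_i) = 2$ for every $2 \le i \le \ell-1$. Let $Z = \{v_3, v_4, \dots, v_\ell\}$. Then $(G,k)$ is a yes-instance if and only if $(G - Z, k)$ is a yes-instance.
   Context: CTVD: given a multigraph $G$ (loops and parallel edges allowed) and an integer $k$, decide whether there is $S\subseteq V(G)$ with $|S|\le k$ such that $G-S$ is simple and every connected component of $G-S$ is a clique or a tree. $d_G(v)$ is the number of edges of $G$ incident to $v$, counted with multiplicity. A path is a sequence of distinct vertices with consecutive ones adjacent. -}

module Defs where

open import Data.Nat using (ℕ; zero; suc; _<_; _≤_)
open import Data.Nat.ListAction using (sum)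
open import Data.Fin using (Fin)
open import Data.Fin.Subset using (Subset; _∈_; _∉_; _⊆_; _─_; ∣_∣)
open import Data.Fin.Subset.Properties using (_∈?_)
open import Data.List using (List; []; _∷_; map; length; allFin; last)
open import Data.List.Relation.Unary.Linked using (Linked)
open import Data.List.Relation.Unary.Unique.Propositional using (Unique)
open import Data.List.Relation.Unary.All using (All)
open import Data.Maybe using (just)
open import Data.Product using (Σ; ∃; _×_; _,_)
open import Data.Sum using (_⊎_)
open import Data.Bool using (Bool; true; false; _∧_; if_then_else_)
open import Relation.Nullary using (¬_; does)
open import Relation.Binary.PropositionalEquality using (_≡_; _≢_; refl; sym)
open import Relation.Binary.Construct.Closure.ReflexiveTransitive using (Star)

-- A finite multigraph whose vertex set is a subset V of Fin n.
-- mult u v = number of (parallel) edges between u and v; mult v v = number of loops at v.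
record Multigraph (n : ℕ) : Set where
  field
    V        : Subset n
    mult     : Fin n → Fin n → ℕ
    mult-sym : ∀ u v → mult u v ≡ mult v u
    mult-V   : ∀ u v → 0 < mult u v → u ∈ V

open Multigraph public

module _ {n : ℕ} (G : Multigraph n) where

  Adj : Fin n → Fin n → Set
  Adj u v = 0 < mult G u v

  -- d_G(v): number of edges incident to v, counted with multiplicity
  -- (each edge, including a loop, counted once)
  deg : Fin n → ℕ
  deg v = sum (map (mult G v) (allFin n))

  Simple : Set
  Simple = (∀ v → mult G v v ≡ 0) × (∀ u v → mult G u v ≤ 1)

  Connected : Fin n → Fin n → Set
  Connected u v = u ∈ V G × v ∈ V G × Star Adj u v

  IsCycle : List (Fin n) → Set
  IsCycle [] = Data.Empty.⊥
    where import Data.Empty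
  IsCycle (x ∷ xs) =
    (3 ≤ length (x ∷ xs)) × Unique (x ∷ xs) × Linked Adj (x ∷ xs)
    × Σ (Fin n) (λ y → (last (x ∷ xs) ≡ just y) × Adj y x)

  Comp : Fin n → Fin n → Set
  Comp v u = Connected v u

  IsCliqueComp : Fin n → Set
  IsCliqueComp v = ∀ u w → Comp v u → Comp v w → u ≢ w → Adj u w

  -- the component is a tree: connected (automatic) and acyclic
  IsTreeComp : Fin n → Set
  IsTreeComp v = ∀ (c : List (Fin n)) → IsCycle c → ¬ All (Comp v) c

  CliqueOrTreeComps : Set
  CliqueOrTreeComps = ∀ v → v ∈ V G → IsCliqueComp v ⊎ IsTreeComp v

infixl 6 _∖_
_∖_ : {n : ℕ} → Multigraph n → Subset n → Multigraph n
_∖_ {n} G S = record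
  { V = W
  ; mult = m
  ; mult-sym = sym′
  ; mult-V = mv
  }
  where
  W = V G ─ S
  m : Fin n → Fin n → ℕ
  m u v = if does (u ∈? W) ∧ does (v ∈? W) then mult G u v else 0
  sym′ : ∀ u v → m u v ≡ m v u
  sym′ u v with u ∈? W | v ∈? W
  ... | Relation.Nullary.yes _ | Relation.Nullary.yes _ = mult-sym G u v
  ... | Relation.Nullary.yes _ | Relation.Nullary.no _ = refl
  ... | Relation.Nullary.no _ | Relation.Nullary.yes _ = refl
  ... | Relation.Nullary.no _ | Relation.Nullary.no _ = refl
  mv : ∀ u v → 0 < m u v → u ∈ W
  mv u v p with u ∈? W | v ∈? W
  ... | Relation.Nullary.yes q | Relation.Nullary.yes _ = q
  mv u v () | Relation.Nullary.yes _ | Relation.Nullary.no _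
  mv u v () | Relation.Nullary.no _ | _

YesInstance : {n : ℕ} → Multigraph n → ℕ → Set
YesInstance {n} G k =
  Σ (Subset n) λ S → S ⊆ V G × ∣ S ∣ ≤ k
    × Simple (G ∖ S) × CliqueOrTreeComps (G ∖ S)

-- (v 0, v 1, ..., v (ℓ-1)) is a path in G (0-indexed)
IsPath : {n : ℕ} → Multigraph n → (ℓ : ℕ) → (ℕ → Fin n) → Set
IsPath G ℓ v =
  (1 ≤ ℓ)
  × (∀ i → i < ℓ → v i ∈ V G)
  × (∀ i j → i < ℓ → j < ℓ → v i ≡ v j → i ≡ j)
  × (∀ i → suc i < ℓ → Adj G (v i) (v (suc i)))

-- Deleting vertices keeps a graph simple with clique-or-tree components, so a solution S
-- of G yields the solution S ─ Z of G ∖ Z.  Conversely, let S solve G ∖ Z.  The degree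
-- conditions say that v 1, …, v (ℓ ∸ 1) are joined by single edges to their path
-- neighbours only, and none of them lies on a cycle: a vertex on a cycle has two distinct
-- neighbours on it, so the cycle would run along the path up to the pendant vertex.  Hence
-- G ∖ S is (G ∖ Z) ∖ S with a pendant path hung at v 1 (if v 1 ∉ S).  It stays simple, and
-- components avoiding Z are unchanged.  A component meeting Z has the same cycles as the
-- component C of v 1 in (G ∖ Z) ∖ S, so it is a tree when C is one, and also when C is a
-- clique: then every vertex of C other than v 1 is a neighbour of v 1 outside Z, i.e. v 0.
module Submission where

open import Data.Bool using (if_then_else_)
open import Data.Empty using (⊥; ⊥-elim)
open import Data.Unit using (⊤; tt)
open import Data.Product using (Σ; ∃; _×_; _,_; proj₁; proj₂)
open import Data.Sum using (_⊎_; inj₁; inj₂)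
open import Data.Nat using (ℕ; zero; suc; _+_; _∸_; _<_; _≤_; z≤n; s≤s; _<?_)
open import Data.Nat.Properties
open import Data.Nat.ListAction using (sum)
open import Algebra.Properties.CommutativeSemigroup +-commutativeSemigroup using (x∙yz≈y∙xz)
open import Data.Fin as Fin using (Fin)
open import Data.Fin.Subset using (Subset; _∈_; _∉_; _⊆_; _─_; inside)
open import Data.Fin.Subset.Properties using (_∈?_; x∈p∧x∉q⇒x∈p─q; p─q⊆p; ∣p─q∣≤∣p∣)
open import Data.Vec using (_∷_; here; there)
open import Data.Maybe using (just)
open import Data.Maybe.Relation.Binary.Connected using (just) renaming (Connected to MaybeConnected)
open import Data.List using (List; []; _∷_; map; length; allFin; tabulate; last; _++_; [_])
open import Data.List.Properties using (map-tabulate; length-map; length-++; map-cong-local; ++-assoc; ++-identityʳ)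
open import Data.List.Relation.Unary.Any using (here; there)
open import Data.List.Relation.Unary.All as All using (All; []; _∷_)
import Data.List.Relation.Unary.All.Properties as All
open import Data.List.Relation.Unary.AllPairs using ([]; _∷_)
open import Data.List.Relation.Unary.Linked using (Linked; []; [-]; _∷_)
import Data.List.Relation.Unary.Linked.Properties as Linked
open import Data.List.Relation.Unary.Unique.Propositional using (Unique)
import Data.List.Relation.Unary.Unique.Propositional.Properties as Unique
open import Data.List.Membership.Propositional using () renaming (_∈_ to _∈ₗ_)
open import Data.List.Membership.Propositional.Properties using (∈-∃++)
import Data.List.Membership.DecPropositional as DecMembership
open import Data.List.Relation.Binary.Permutation.Propositional using (↭-sym)
open import Data.List.Relation.Binary.Permutation.Propositional.Properties
  using (∈-resp-↭) renaming (++-comm to ↭-++-comm)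
open import Function using (_∘_)
open import Function.Bundles using (_⇔_; mk⇔; Equivalence)
open import Relation.Nullary using (¬_; Dec; yes; no; does; contradiction; _⊎-dec_)
open import Relation.Binary.PropositionalEquality hiding ([_])
open import Relation.Binary.Construct.Closure.ReflexiveTransitive as Star using (Star; ε; _◅_; _◅◅_)

open import Defs

last-∈ : ∀ {A : Set} {x : A} {xs y} → last (x ∷ xs) ≡ just y → y ∈ₗ x ∷ xs
last-∈ {xs = []}     refl = here refl
last-∈ {xs = _ ∷ _} eq   = there (last-∈ eq)

_without_ : ∀ {n} → (Fin n → ℕ) → Fin n → Fin n → ℕ
(f without x) u = if does (u Fin.≟ x) then 0 else f u

sum-tabulate-without : ∀ {n} (f : Fin n → ℕ) x → sum (tabulate f) ≡ f x + sum (tabulate (f without x))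
sum-tabulate-without f Fin.zero    = refl
sum-tabulate-without f (Fin.suc x) = begin
  f₀ + sum (tabulate f′)                      ≡⟨ cong (f₀ +_) (sum-tabulate-without f′ x) ⟩
  f₀ + (f′ x + sum (tabulate (f′ without x))) ≡⟨ x∙yz≈y∙xz f₀ (f′ x) _ ⟩
  f′ x + (f₀ + sum (tabulate (f′ without x))) ∎
  where
  open ≡-Reasoning
  f₀ = f Fin.zero
  f′ = f ∘ Fin.suc

sum-map≤sum-tabulate : ∀ {n} (f : Fin n → ℕ) {xs} → Unique xs → sum (map f xs) ≤ sum (tabulate f)
sum-map≤sum-tabulate f {[]}     _              = z≤n
sum-map≤sum-tabulate f {x ∷ xs} (x∉xs ∷ uniq) = begin
  f x + sum (map f xs)                  ≡⟨ cong (λ ys → f x + sum ys) (map-cong-local (All.map off x∉xs)) ⟨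
  f x + sum (map (f without x) xs)      ≤⟨ +-monoʳ-≤ (f x) (sum-map≤sum-tabulate (f without x) uniq) ⟩
  f x + sum (tabulate (f without x))    ≡⟨ sum-tabulate-without f x ⟨
  sum (tabulate f)                      ∎
  where open ≤-Reasoning
        off : ∀ {y} → x ≢ y → (f without x) y ≡ f y
        off {y} x≢y with y Fin.≟ x
        ... | yes y≡x = contradiction (sym y≡x) x≢y
        ... | no _    = refl

sum-map≤sum-allFin : ∀ {n} (f : Fin n → ℕ) {xs} → Unique xs → sum (map f xs) ≤ sum (map f (allFin n))
sum-map≤sum-allFin f uniq =
  ≤-trans (sum-map≤sum-tabulate f uniq) (≤-reflexive (cong sum (sym (map-tabulate (λ x → x) f))))

length≤sum : ∀ {ms} → All (1 ≤_) ms → length ms ≤ sum ms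
length≤sum []          = z≤n
length≤sum (1≤m ∷ 1≤ms) = +-mono-≤ 1≤m (length≤sum 1≤ms)

sum≤length⇒All≡1 : ∀ {ms} → All (1 ≤_) ms → sum ms ≤ length ms → All (_≡ 1) ms
sum≤length⇒All≡1 []                        _  = []
sum≤length⇒All≡1 {m ∷ ms} (1≤m ∷ 1≤ms) ≤len =
  ≤-antisym m≤1 1≤m
  ∷ sum≤length⇒All≡1 1≤ms (+-cancelˡ-≤ 1 _ _ (≤-trans (+-monoˡ-≤ (sum ms) 1≤m) ≤len))
  where
  m≤1 : m ≤ 1
  m≤1 = +-cancelʳ-≤ (length ms) m 1 (≤-trans (+-monoʳ-≤ m (length≤sum 1≤ms)) ≤len)

module _ {A : Set} (R : A → A → Set) where

  Cyclic : List A → Set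
  Cyclic []       = ⊥
  Cyclic (x ∷ xs) = 3 ≤ length (x ∷ xs) × Unique (x ∷ xs) × Linked R (x ∷ xs ++ [ x ])

  TwoNeighbours : A → List A → Set
  TwoNeighbours z c = ∃ λ a → ∃ λ b → a ∈ₗ c × b ∈ₗ c × a ≢ b × R z a × R z b

  private
    Linked-snoc : ∀ {x y} zs → Linked R (zs ++ [ x ]) → R x y → Linked R ((zs ++ [ x ]) ++ [ y ])
    Linked-snoc []           [-]          x~y = x~y ∷ [-]
    Linked-snoc (_ ∷ [])     (z~x ∷ [-])  x~y = z~x ∷ x~y ∷ [-]
    Linked-snoc (_ ∷ w ∷ zs) (z~w ∷ rest) x~y = z~w ∷ Linked-snoc (w ∷ zs) rest x~y

    Linked-snoc⁻ : ∀ {z} w ws → Linked R (w ∷ ws ++ [ z ])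
                 → ∃ λ a → last (w ∷ ws) ≡ just a × R a z
    Linked-snoc⁻ w []        (w~z ∷ [-])  = w , refl , w~z
    Linked-snoc⁻ w (w′ ∷ ws) (_ ∷ rest)   = Linked-snoc⁻ w′ ws rest

    Unique-snoc : ∀ {x : A} xs → Unique (x ∷ xs) → Unique (xs ++ [ x ])
    Unique-snoc xs (x∉xs ∷ uniq) =
      Unique.++⁺ uniq ([] ∷ []) λ { (v∈xs , here refl) → All.lookup x∉xs v∈xs refl }

  Cyclic-rotate₁ : ∀ x xs → Cyclic (x ∷ xs) → Cyclic (xs ++ [ x ])
  Cyclic-rotate₁ x []       (s≤s () , _)
  Cyclic-rotate₁ x (y ∷ ys) (len , uniq , x~y ∷ walk) =
    subst (3 ≤_) (trans (sym (+-comm (length (y ∷ ys)) 1)) (sym (length-++ (y ∷ ys)))) len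
    , Unique-snoc (y ∷ ys) uniq
    , Linked-snoc (y ∷ ys) walk x~y

  Cyclic-rotate : ∀ pre z suf → Cyclic (pre ++ z ∷ suf) → Cyclic (z ∷ suf ++ pre)
  Cyclic-rotate []        z suf cyc = subst (λ t → Cyclic (z ∷ t)) (sym (++-identityʳ suf)) cyc
  Cyclic-rotate (p ∷ pre) z suf cyc =
    subst (λ t → Cyclic (z ∷ t)) (++-assoc suf [ p ] pre)
      (Cyclic-rotate pre z (suf ++ [ p ])
        (subst Cyclic (++-assoc pre (z ∷ suf) [ p ]) (Cyclic-rotate₁ p (pre ++ z ∷ suf) cyc)))

  module _ (R-sym : ∀ {a b} → R a b → R b a) where

    Cyclic-head-neighbours : ∀ z zs → Cyclic (z ∷ zs) → TwoNeighbours z (z ∷ zs)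
    Cyclic-head-neighbours z []            (s≤s () , _)
    Cyclic-head-neighbours z (_ ∷ [])      (s≤s (s≤s ()) , _)
    Cyclic-head-neighbours z (y ∷ y′ ∷ ys) (_ , _ ∷ y∉ ∷ _ , z~y ∷ _ ∷ walk)
      with a , last≡a , a~z ← Linked-snoc⁻ y′ ys walk =
      y , a , there (here refl) , there (there a∈) , (λ y≡a → All.lookup y∉ a∈ y≡a) , z~y , R-sym a~z
      where a∈ = last-∈ last≡a

    Cyclic⇒TwoNeighbours : ∀ {c z} → Cyclic c → z ∈ₗ c → TwoNeighbours z c
    Cyclic⇒TwoNeighbours {z = z} cyc z∈c with pre , suf , refl ← ∈-∃++ z∈c
      with a , b , a∈ , b∈ , a≢b , z~a , z~b
             ← Cyclic-head-neighbours z (suf ++ pre) (Cyclic-rotate pre z suf cyc)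
      = a , b , unrotate a∈ , unrotate b∈ , a≢b , z~a , z~b
      where
      unrotate : ∀ {q} → q ∈ₗ z ∷ suf ++ pre → q ∈ₗ pre ++ z ∷ suf
      unrotate = ∈-resp-↭ (↭-sym (↭-++-comm pre (z ∷ suf)))

x∈p─q⇒x∉q : ∀ {n} {p q : Subset n} {x} → x ∈ p ─ q → x ∉ q
x∈p─q⇒x∉q {p = _ ∷ _} {inside ∷ _} {Fin.zero} () here
x∈p─q⇒x∉q {p = _ ∷ _} {_ ∷ _} {Fin.suc _} (there x∈) (there x∈q) = x∈p─q⇒x∉q x∈ x∈q

module _ {n : ℕ} (G : Multigraph n) where

  Adj-sym : ∀ {a b} → Adj G a b → Adj G b a
  Adj-sym {a} {b} = subst (0 <_) (mult-sym G a b)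

  Adj⇒∈V : ∀ {a b} → Adj G a b → a ∈ V G
  Adj⇒∈V {a} {b} = mult-V G a b

  Star-reverse : ∀ {a b} → Star (Adj G) a b → Star (Adj G) b a
  Star-reverse = Star.reverse Adj-sym

  Star⇒∈V : ∀ {a b} → Star (Adj G) a b → a ∈ V G → b ∈ V G
  Star⇒∈V ε a∈V = a∈V
  Star⇒∈V (a~c ◅ c~b) _ = Star⇒∈V c~b (Adj⇒∈V (Adj-sym a~c))

  mult-∉Vˡ : ∀ {a} b → a ∉ V G → mult G a b ≡ 0
  mult-∉Vˡ {a} b a∉V with mult G a b in eq
  ... | zero  = refl
  ... | suc _ = contradiction (mult-V G a b (subst (0 <_) (sym eq) (s≤s z≤n))) a∉V

  mult-∉Vʳ : ∀ a {b} → b ∉ V G → mult G a b ≡ 0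
  mult-∉Vʳ a {b} b∉V = trans (mult-sym G a b) (mult-∉Vˡ a b∉V)

∈V-∖ : ∀ {n} {G : Multigraph n} {S x} → x ∈ V (G ∖ S) → x ∈ V G × x ∉ S
∈V-∖ {G = G} {S} x∈ = p─q⊆p (V G) S x∈ , x∈p─q⇒x∉q x∈

module _ {n : ℕ} {H K : Multigraph n} (P : Fin n → Set)
         (Adj⇒ : ∀ {a b} → P a → P b → Adj H a b → Adj K a b) where

  Linked-transfer : ∀ {c} → All P c → Linked (Adj H) c → Linked (Adj K) c
  Linked-transfer _                []          = []
  Linked-transfer _                [-]         = [-]
  Linked-transfer (Pa ∷ Pb ∷ Pc) (a~b ∷ b~c) = Adj⇒ Pa Pb a~b ∷ Linked-transfer (Pb ∷ Pc) b~c

  IsCycle-transfer : ∀ {c} → All P c → IsCycle H c → IsCycle K c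
  IsCycle-transfer {x ∷ xs} Pc (len , uniq , linked , y , last≡y , y~x) =
    len , uniq , Linked-transfer Pc linked , y , last≡y
    , Adj⇒ (All.lookup Pc (last-∈ last≡y)) (All.lookup Pc (here refl)) y~x

IsCycle-mono : ∀ {n} {H K : Multigraph n} → (∀ {a b} → Adj H a b → Adj K a b)
             → ∀ {c} → IsCycle H c → IsCycle K c
IsCycle-mono Adj⇒ = IsCycle-transfer (λ _ → ⊤) (λ _ _ → Adj⇒) (All.universal (λ _ → tt) _)

IsCycle⇒Cyclic : ∀ {n} (G : Multigraph n) {c} → IsCycle G c → Cyclic (Adj G) c
IsCycle⇒Cyclic G {x ∷ xs} (len , uniq , walk , y , last≡y , y~x) =
  len , uniq , Linked.++⁺ walk (subst (λ m → MaybeConnected (Adj G) m (just x)) (sym last≡y) (just y~x)) [-]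

IsCycle⇒TwoNeighbours : ∀ {n} (G : Multigraph n) {c z}
                      → IsCycle G c → z ∈ₗ c → TwoNeighbours (Adj G) z c
IsCycle⇒TwoNeighbours G cyc = Cyclic⇒TwoNeighbours (Adj G) (Adj-sym G) (IsCycle⇒Cyclic G cyc)

record Induced {n : ℕ} (H K : Multigraph n) : Set where
  field
    V⊆     : V H ⊆ V K
    mult-≡ : ∀ {a b} → a ∈ V H → b ∈ V H → mult H a b ≡ mult K a b

  mult-≡-reflecting : ∀ {a b} → (a ∈ V K → a ∈ V H) → (b ∈ V K → b ∈ V H)
                    → mult H a b ≡ mult K a b
  mult-≡-reflecting {a} {b} a↓ b↓ with a ∈? V H | b ∈? V H
  ... | yes a∈ | yes b∈ = mult-≡ a∈ b∈
  ... | no a∉  | _      = trans (mult-∉Vˡ H b a∉) (sym (mult-∉Vˡ K b (a∉ ∘ a↓)))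
  ... | yes _  | no b∉  = trans (mult-∉Vʳ H a b∉) (sym (mult-∉Vʳ K a (b∉ ∘ b↓)))

module _ {n : ℕ} {H K : Multigraph n} (H≤K : Induced H K) where
  open Induced H≤K

  mult-≤ : ∀ a b → mult H a b ≤ mult K a b
  mult-≤ a b with a ∈? V H | b ∈? V H
  ... | yes a∈ | yes b∈ = ≤-reflexive (mult-≡ a∈ b∈)
  ... | no a∉  | _      = ≤-trans (≤-reflexive (mult-∉Vˡ H b a∉)) z≤n
  ... | yes _  | no b∉  = ≤-trans (≤-reflexive (mult-∉Vʳ H a b∉)) z≤n

  Adj⁺ : ∀ {a b} → Adj H a b → Adj K a b
  Adj⁺ {a} {b} a~b = ≤-trans a~b (mult-≤ a b)

  Adj⁻ : ∀ {a b} → a ∈ V H → b ∈ V H → Adj K a b → Adj H a b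
  Adj⁻ a∈ b∈ = subst (0 <_) (sym (mult-≡ a∈ b∈))

  Comp⁺ : ∀ {w u} → Comp H w u → Comp K w u
  Comp⁺ (w∈ , u∈ , w~u) = V⊆ w∈ , V⊆ u∈ , Star.map Adj⁺ w~u

  hereditary : Simple K → CliqueOrTreeComps K → Simple H × CliqueOrTreeComps H
  hereditary (loopless , ≤1) cliqueOrTree =
    ((λ u → n≤0⇒n≡0 (≤-trans (mult-≤ u u) (≤-reflexive (loopless u))))
    , (λ a b → ≤-trans (mult-≤ a b) (≤1 a b)))
    , λ w w∈ → restrict (cliqueOrTree w (V⊆ w∈))
    where
    restrict : ∀ {w} → IsCliqueComp K w ⊎ IsTreeComp K w → IsCliqueComp H w ⊎ IsTreeComp H w
    restrict (inj₁ clique) = inj₁ λ u x w~u w~x u≢x →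
      Adj⁻ (proj₁ (proj₂ w~u)) (proj₁ (proj₂ w~x)) (clique u x (Comp⁺ w~u) (Comp⁺ w~x) u≢x)
    restrict (inj₂ tree) = inj₂ λ c cycle inComp →
      tree c (IsCycle-mono Adj⁺ cycle) (All.map Comp⁺ inComp)

∖-Induced : ∀ {n} (G : Multigraph n) S → Induced (G ∖ S) G
∖-Induced G S = record { V⊆ = p─q⊆p (V G) S ; mult-≡ = mult-≡ }
  where
  mult-≡ : ∀ {a b} → a ∈ V (G ∖ S) → b ∈ V (G ∖ S) → mult (G ∖ S) a b ≡ mult G a b
  mult-≡ {a} {b} a∈ b∈ with a ∈? V G ─ S | b ∈? V G ─ S
  ... | yes _  | yes _  = refl
  ... | no a∉  | _      = contradiction a∈ a∉
  ... | yes _  | no b∉  = contradiction b∈ b∉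

Induced-trans : ∀ {n} {G H K : Multigraph n} → Induced G H → Induced H K → Induced G K
Induced-trans G≤H H≤K = record
  { V⊆    = V⊆ H≤K ∘ V⊆ G≤H
  ; mult-≡ = λ a∈ b∈ → trans (mult-≡ G≤H a∈ b∈) (mult-≡ H≤K (V⊆ G≤H a∈) (V⊆ G≤H b∈))
  }
  where open Induced

Induced-⊆ : ∀ {n} {G H K : Multigraph n} → Induced H G → Induced K G → V H ⊆ V K → Induced H K
Induced-⊆ H≤G K≤G V⊆V = record
  { V⊆    = V⊆V
  ; mult-≡ = λ a∈ b∈ → trans (mult-≡ H≤G a∈ b∈) (sym (mult-≡ K≤G (V⊆V a∈) (V⊆V b∈)))
  }
  where open Induced

YesInstance-∖ : ∀ {n} (G : Multigraph n) Z k → YesInstance G k → YesInstance (G ∖ Z) k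
YesInstance-∖ G Z k (S , S⊆V , ∣S∣≤k , simple , cliqueOrTree) =
  S ─ Z , S─Z⊆V , ≤-trans (∣p─q∣≤∣p∣ S Z) ∣S∣≤k , hereditary H≤K simple cliqueOrTree
  where
  S─Z⊆V : S ─ Z ⊆ V (G ∖ Z)
  S─Z⊆V x∈ = x∈p∧x∉q⇒x∈p─q (S⊆V (p─q⊆p S Z x∈)) (x∈p─q⇒x∉q x∈)
  H≤K : Induced ((G ∖ Z) ∖ (S ─ Z)) (G ∖ S)
  H≤K = Induced-⊆ (Induced-trans (∖-Induced (G ∖ Z) (S ─ Z)) (∖-Induced G Z)) (∖-Induced G S) V⊆V
    where
    V⊆V : V ((G ∖ Z) ∖ (S ─ Z)) ⊆ V (G ∖ S)
    V⊆V x∈ with ∈V-∖ {G = G ∖ Z} x∈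
    ... | x∈G─Z , x∉S─Z with ∈V-∖ {G = G} x∈G─Z
    ... | x∈G , x∉Z = x∈p∧x∉q⇒x∈p─q x∈G λ x∈S → x∉S─Z (x∈p∧x∉q⇒x∈p─q x∈S x∉Z)

module _ {n : ℕ} (G : Multigraph n) {t : Fin n} {xs : List (Fin n)}
         (uniq : Unique xs) (t~xs : All (Adj G t) xs) (deg≤ : deg G t ≤ length xs) where

  private
    f = mult G t

    1≤f : All (1 ≤_) (map f xs)
    1≤f = All.map⁺ t~xs

    sum≤length : sum (map f xs) ≤ length (map f xs)
    sum≤length = begin
      sum (map f xs)    ≤⟨ sum-map≤sum-allFin f uniq ⟩
      deg G t           ≤⟨ deg≤ ⟩
      length xs         ≡⟨ length-map f xs ⟨
      length (map f xs) ∎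
      where open ≤-Reasoning

    f≡1 : All (λ u → f u ≡ 1) xs
    f≡1 = All.map⁻ (sum≤length⇒All≡1 1≤f sum≤length)

  deg≤length⇒neighbour-∈ : ∀ {u} → Adj G t u → u ∈ₗ xs
  deg≤length⇒neighbour-∈ {u} t~u with DecMembership._∈?_ (Fin._≟_ {n}) u xs
  ... | yes u∈xs = u∈xs
  ... | no  u∉xs = ⊥-elim (<-irrefl refl (begin-strict
    sum (map f xs)            <⟨ +-monoˡ-≤ (sum (map f xs)) t~u ⟩
    f u + sum (map f xs)      ≤⟨ sum-map≤sum-allFin f (All.¬Any⇒All¬ xs u∉xs ∷ uniq) ⟩
    deg G t                   ≤⟨ deg≤ ⟩
    length xs                 ≡⟨ length-map f xs ⟨
    length (map f xs)         ≤⟨ length≤sum 1≤f ⟩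
    sum (map f xs)            ∎))
    where open ≤-Reasoning

  deg≤length⇒mult≤1 : ∀ u → mult G t u ≤ 1
  deg≤length⇒mult≤1 u with mult G t u in eq
  ... | zero  = z≤n
  ... | suc _ = ≤-reflexive (trans (sym eq) (All.lookup f≡1 (deg≤length⇒neighbour-∈ t~u)))
    where t~u = subst (0 <_) (sym eq) (s≤s z≤n)

module PendantPath {n : ℕ} (G : Multigraph n) (ℓ : ℕ) (v : ℕ → Fin n) (path : IsPath G ℓ v)
                   (deg-v₀ : 2 < deg G (v 0))
                   (deg-end : deg G (v (ℓ ∸ 1)) ≡ 1)
                   (deg-inner : ∀ i → 1 ≤ i → i < ℓ ∸ 1 → deg G (v i) ≡ 2) where

  private
    v-injective : ∀ {i j} → i < ℓ → j < ℓ → v i ≡ v j → i ≡ j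
    v-injective = proj₁ (proj₂ (proj₂ path)) _ _

    v~v : ∀ i → suc i < ℓ → Adj G (v i) (v (suc i))
    v~v = proj₂ (proj₂ (proj₂ path))

  1<ℓ : 1 < ℓ
  1<ℓ = ≤∧≢⇒< (proj₁ path) λ 1≡ℓ →
    <⇒≱ deg-v₀ (≤-trans (≤-reflexive (subst (λ i → deg G (v (i ∸ 1)) ≡ 1) (sym 1≡ℓ) deg-end))
                        (n≤1+n 1))

  interior-neighbourhood : ∀ j → suc j < ℓ →
    ∃ λ xs → Unique xs × All (Adj G (v (suc j))) xs × deg G (v (suc j)) ≤ length xs
           × (∀ {u} → u ∈ₗ xs → u ≡ v j ⊎ (suc (suc j) < ℓ × u ≡ v (suc (suc j))))
  interior-neighbourhood j j+1<ℓ with suc (suc j) <? ℓ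
  ... | yes j+2<ℓ =
    v j ∷ v (suc (suc j)) ∷ []
    , ((m≢1+n+m j ∘ v-injective (<-trans (n<1+n j) j+1<ℓ) j+2<ℓ) ∷ []) ∷ [] ∷ []
    , Adj-sym G (v~v j j+1<ℓ) ∷ v~v (suc j) j+2<ℓ ∷ []
    , ≤-reflexive (deg-inner (suc j) (s≤s z≤n) (∸-monoˡ-≤ 1 j+2<ℓ))
    , λ { (here eq) → inj₁ eq ; (there (here eq)) → inj₂ (j+2<ℓ , eq) }
  ... | no j+2≮ℓ =
    v j ∷ []
    , [] ∷ []
    , Adj-sym G (v~v j j+1<ℓ) ∷ []
    , ≤-reflexive (subst (λ i → deg G (v (i ∸ 1)) ≡ 1) (≤-antisym (≮⇒≥ j+2≮ℓ) j+1<ℓ) deg-end)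
    , λ { (here eq) → inj₁ eq }

  interior-neighbours : ∀ {j u} → suc j < ℓ → Adj G (v (suc j)) u
                      → u ≡ v j ⊎ (suc (suc j) < ℓ × u ≡ v (suc (suc j)))
  interior-neighbours {j} j+1<ℓ t~u
    with _ , uniq , t~xs , deg≤ , members ← interior-neighbourhood j j+1<ℓ =
    members (deg≤length⇒neighbour-∈ G uniq t~xs deg≤ t~u)

  interior-mult≤1 : ∀ {j} → suc j < ℓ → ∀ u → mult G (v (suc j)) u ≤ 1
  interior-mult≤1 {j} j+1<ℓ with _ , uniq , t~xs , deg≤ , _ ← interior-neighbourhood j j+1<ℓ =
    deg≤length⇒mult≤1 G uniq t~xs deg≤

  interior-loopless : ∀ {j} → suc j < ℓ → mult G (v (suc j)) (v (suc j)) ≡ 0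
  interior-loopless {j} j+1<ℓ with mult G (v (suc j)) (v (suc j)) in eq
  ... | zero  = refl
  ... | suc _ with interior-neighbours j+1<ℓ (subst (0 <_) (sym eq) (s≤s z≤n))
  ...   | inj₁ eq′           = ⊥-elim (1+n≢n (v-injective j+1<ℓ (<-trans (n<1+n j) j+1<ℓ) eq′))
  ...   | inj₂ (j+2<ℓ , eq′) = ⊥-elim (1+n≢n (sym (v-injective j+1<ℓ j+2<ℓ eq′)))

  interior-next-on-cycle : ∀ {c j} → IsCycle G c → suc j < ℓ → v (suc j) ∈ₗ c
                         → suc (suc j) < ℓ × v (suc (suc j)) ∈ₗ c
  interior-next-on-cycle cyc j+1<ℓ t∈c
    with a , b , a∈c , b∈c , a≢b , t~a , t~b ← IsCycle⇒TwoNeighbours G cyc t∈c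
    with interior-neighbours j+1<ℓ t~a | interior-neighbours j+1<ℓ t~b
  ... | inj₂ (j+2<ℓ , refl) | _                   = j+2<ℓ , a∈c
  ... | inj₁ _              | inj₂ (j+2<ℓ , refl) = j+2<ℓ , b∈c
  ... | inj₁ refl           | inj₁ refl           = ⊥-elim (a≢b refl)

  interior-off-cycle : ∀ {c j} → IsCycle G c → suc j < ℓ → ¬ v (suc j) ∈ₗ c
  interior-off-cycle {c} cyc = go ℓ (m≤n+m ℓ _)
    where
    go : ∀ d {j} → ℓ ≤ suc j + d → suc j < ℓ → ¬ v (suc j) ∈ₗ c
    go zero    {j} ℓ≤ j+1<ℓ _ = <⇒≱ j+1<ℓ (≤-trans ℓ≤ (≤-reflexive (+-identityʳ (suc j))))
    go (suc d) {j} ℓ≤ j+1<ℓ t∈c with j+2<ℓ , t′∈c ← interior-next-on-cycle cyc j+1<ℓ t∈c =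
      go d (≤-trans ℓ≤ (≤-reflexive (+-suc (suc j) d))) j+2<ℓ t′∈c

  module Tail (Z : Subset n) (Z-spec : ∀ u → u ∈ Z ⇔ Σ ℕ (λ i → 2 ≤ i × i < ℓ × v i ≡ u)) where

    ∈Z : ∀ {i} → 2 ≤ i → i < ℓ → v i ∈ Z
    ∈Z {i} 2≤i i<ℓ = Equivalence.from (Z-spec (v i)) (i , 2≤i , i<ℓ , refl)

    Z-mult≤1 : ∀ {u} → u ∈ Z → ∀ w → mult G u w ≤ 1
    Z-mult≤1 {u} u∈Z with Equivalence.to (Z-spec u) u∈Z
    ... | suc _ , _ , i<ℓ , refl = interior-mult≤1 i<ℓ

    Z-loopless : ∀ {u} → u ∈ Z → mult G u u ≡ 0
    Z-loopless {u} u∈Z with Equivalence.to (Z-spec u) u∈Z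
    ... | suc _ , _ , i<ℓ , refl = interior-loopless i<ℓ

    Z-off-cycle : ∀ {c x} → IsCycle G c → x ∈ₗ c → x ∉ Z
    Z-off-cycle cyc x∈c x∈Z with Equivalence.to (Z-spec _) x∈Z
    ... | suc _ , _ , i<ℓ , refl = interior-off-cycle cyc i<ℓ x∈c

    v₁-off-cycle : ∀ {c} → IsCycle G c → ¬ v 1 ∈ₗ c
    v₁-off-cycle cyc = interior-off-cycle cyc 1<ℓ

    v₁-neighbours : ∀ {x} → Adj G (v 1) x → x ≡ v 0 ⊎ x ∈ Z
    v₁-neighbours v₁~x with interior-neighbours 1<ℓ v₁~x
    ... | inj₁ eq           = inj₁ eq
    ... | inj₂ (2<ℓ , refl) = inj₂ (∈Z ≤-refl 2<ℓ)

    Z-boundary : ∀ {a z} → a ∉ Z → z ∈ Z → Adj G a z → a ≡ v 1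
    Z-boundary a∉Z z∈Z a~z with Equivalence.to (Z-spec _) z∈Z
    ... | suc zero , s≤s () , _
    ... | suc (suc j) , _ , i<ℓ , refl with interior-neighbours i<ℓ (Adj-sym G a~z)
    ...   | inj₂ (j+3<ℓ , refl) = ⊥-elim (a∉Z (∈Z (s≤s (s≤s z≤n)) j+3<ℓ))
    ...   | inj₁ refl with j
    ...     | zero   = refl
    ...     | suc j′ = ⊥-elim (a∉Z (∈Z (s≤s (s≤s z≤n)) (<-trans (n<1+n _) i<ℓ)))

    module Restore (S : Subset n) (simple : Simple ((G ∖ Z) ∖ S))
                   (cliqueOrTree : CliqueOrTreeComps ((G ∖ Z) ∖ S)) where

      H K : Multigraph n
      H = (G ∖ Z) ∖ S
      K = G ∖ S

      K≤G : Induced K G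
      K≤G = ∖-Induced G S

      H≤K : Induced H K
      H≤K = Induced-⊆ (Induced-trans (∖-Induced (G ∖ Z) S) (∖-Induced G Z)) K≤G V⊆V
        where
        V⊆V : V H ⊆ V K
        V⊆V x∈H with x∈G─Z , x∉S ← ∈V-∖ {G = G ∖ Z} x∈H =
          x∈p∧x∉q⇒x∈p─q (proj₁ (∈V-∖ {G = G} x∈G─Z)) x∉S

      ∈V-H : ∀ {x} → x ∈ V K → x ∉ Z → x ∈ V H
      ∈V-H x∈K x∉Z with x∈G , x∉S ← ∈V-∖ {G = G} x∈K =
        x∈p∧x∉q⇒x∈p─q (x∈p∧x∉q⇒x∈p─q x∈G x∉Z) x∉S

      mult-H≡K : ∀ {a b} → a ∉ Z → b ∉ Z → mult H a b ≡ mult K a b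
      mult-H≡K a∉Z b∉Z =
        Induced.mult-≡-reflecting H≤K (λ a∈K → ∈V-H a∈K a∉Z) (λ b∈K → ∈V-H b∈K b∉Z)

      Adj-K⇒H : ∀ {a b} → a ∉ Z → b ∉ Z → Adj K a b → Adj H a b
      Adj-K⇒H a∉Z b∉Z = subst (0 <_) (sym (mult-H≡K a∉Z b∉Z))

      Adj-H⇒G : ∀ {a b} → Adj H a b → Adj G a b
      Adj-H⇒G = Adj⁺ K≤G ∘ Adj⁺ H≤K

      -- Every edge leaving Z ends at v 1 (Z-boundary), so collapsing Z onto v 1 maps walks
      -- of K to walks of H.
      collapse : Fin n → Fin n
      collapse u = if does (u ∈? Z) then v 1 else u

      collapse-∈Z : ∀ {u} → u ∈ Z → collapse u ≡ v 1
      collapse-∈Z {u} u∈Z with u ∈? Z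
      ... | yes _   = refl
      ... | no u∉Z = contradiction u∈Z u∉Z

      collapse-∉Z : ∀ {u} → u ∉ Z → collapse u ≡ u
      collapse-∉Z {u} u∉Z with u ∈? Z
      ... | yes u∈Z = contradiction u∈Z u∉Z
      ... | no _    = refl

      Adj-collapse : ∀ {a b} → Adj K a b → Star (Adj H) (collapse a) (collapse b)
      Adj-collapse {a} {b} a~b with a ∈? Z | b ∈? Z
      ... | yes _   | yes _   = ε
      ... | no a∉Z  | no b∉Z  = Adj-K⇒H a∉Z b∉Z a~b ◅ ε
      ... | no a∉Z  | yes b∈Z = subst (Star (Adj H) a) (Z-boundary a∉Z b∈Z (Adj⁺ K≤G a~b)) ε
      ... | yes a∈Z | no b∉Z  =
        subst (λ x → Star (Adj H) x b) (Z-boundary b∉Z a∈Z (Adj⁺ K≤G (Adj-sym K a~b))) ε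

      Star-collapse : ∀ {a b} → Star (Adj K) a b → Star (Adj H) (collapse a) (collapse b)
      Star-collapse ε           = ε
      Star-collapse (a~c ◅ c⇝b) = Adj-collapse a~c ◅◅ Star-collapse c⇝b

      Comp-collapse : ∀ {w u} → collapse w ∈ V H → Comp K w u → Comp H (collapse w) (collapse u)
      Comp-collapse w∈H (_ , _ , w⇝u) = w∈H , Star⇒∈V H (Star-collapse w⇝u) w∈H , Star-collapse w⇝u

      module _ {c : List (Fin n)} (cyc : IsCycle K c) where

        cycle-∉Z : ∀ {x} → x ∈ₗ c → x ∉ Z
        cycle-∉Z = Z-off-cycle (IsCycle-mono (Adj⁺ K≤G) cyc)

        cycle-≢v₁ : ∀ {x} → x ∈ₗ c → x ≢ v 1
        cycle-≢v₁ x∈c refl = v₁-off-cycle (IsCycle-mono (Adj⁺ K≤G) cyc) x∈c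

        cycle-K⇒H : IsCycle H c
        cycle-K⇒H = IsCycle-transfer (_∉ Z) Adj-K⇒H (All.tabulate cycle-∉Z) cyc

        cycle-Comp : ∀ {w x} → x ∈ₗ c → Comp K w x → Comp H (collapse w) x
        cycle-Comp {w} {x} x∈c (_ , x∈K , w⇝x) =
          Star⇒∈V H (Star-reverse H w′⇝x) x∈H , x∈H , w′⇝x
          where
          x∉Z = cycle-∉Z x∈c
          x∈H = ∈V-H x∈K x∉Z
          w′⇝x : Star (Adj H) (collapse w) x
          w′⇝x = subst (Star (Adj H) (collapse w)) (collapse-∉Z x∉Z) (Star-collapse w⇝x)

      cycle-Comps : ∀ {w c} → IsCycle K c → All (Comp K w) c → All (Comp H (collapse w)) c
      cycle-Comps cyc inComp = All.tabulate λ x∈c → cycle-Comp cyc x∈c (All.lookup inComp x∈c)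

      -- A decidable stand-in for "v 1 is in the component of collapse w", equivalent to it
      -- when that component is a clique.
      Touches-v₁ : Fin n → Set
      Touches-v₁ w = collapse w ≡ v 1 ⊎ Adj H (collapse w) (v 1)

      Touches-v₁? : ∀ w → Dec (Touches-v₁ w)
      Touches-v₁? w = (collapse w Fin.≟ v 1) ⊎-dec (0 <? mult H (collapse w) (v 1))

      Touches-v₁⇒Comp : ∀ {w} → collapse w ∈ V H → Touches-v₁ w → Comp H (collapse w) (v 1)
      Touches-v₁⇒Comp {w} w∈H (inj₁ w≡v₁) = subst (Comp H (collapse w)) w≡v₁ (w∈H , w∈H , ε)
      Touches-v₁⇒Comp {w} w∈H (inj₂ w~v₁) = w∈H , Adj⇒∈V H (Adj-sym H {collapse w} w~v₁) , w~v₁ ◅ ε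

      clique-at-v₁⇒tree : ∀ {w} → IsCliqueComp H (collapse w) → Comp H (collapse w) (v 1) → IsTreeComp K w
      clique-at-v₁⇒tree clique v₁∈ [] ()
      clique-at-v₁⇒tree clique v₁∈ (_ ∷ []) (s≤s () , _)
      clique-at-v₁⇒tree clique v₁∈ (x ∷ y ∷ _) cyc@(_ , (x≢y ∷ _) ∷ _ , _) (x∈ ∷ y∈ ∷ _) =
        x≢y (trans (≡v₀ (here refl) x∈) (sym (≡v₀ (there (here refl)) y∈)))
        where
        ≡v₀ : ∀ {u} → u ∈ₗ x ∷ y ∷ _ → Comp K _ u → u ≡ v 0
        ≡v₀ u∈c u∈ with v₁-neighbours (Adj-H⇒G v₁~u)
          where v₁~u = clique (v 1) _ v₁∈ (cycle-Comp cyc u∈c u∈) (cycle-≢v₁ cyc u∈c ∘ sym)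
        ... | inj₁ u≡v₀ = u≡v₀
        ... | inj₂ u∈Z  = contradiction u∈Z (cycle-∉Z cyc u∈c)

      clique-off-v₁⇒clique : ∀ {w} → collapse w ∈ V H → IsCliqueComp H (collapse w) → ¬ Touches-v₁ w
                           → IsCliqueComp K w
      clique-off-v₁⇒clique {w} w∈H clique untouched u x u∈ x∈ u≢x =
        Adj⁺ H≤K (clique u x (Comp-collapse-∉Z u∈) (Comp-collapse-∉Z x∈) u≢x)
        where
        comp-∉Z : ∀ {u} → Comp K w u → u ∉ Z
        comp-∉Z u∈ u∈Z = untouched (inj₂ (clique _ _ (w∈H , w∈H , ε) v₁∈ (untouched ∘ inj₁)))
          where v₁∈ = subst (Comp H (collapse w)) (collapse-∈Z u∈Z) (Comp-collapse w∈H u∈)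
        Comp-collapse-∉Z : ∀ {u} → Comp K w u → Comp H (collapse w) u
        Comp-collapse-∉Z u∈ =
          subst (Comp H (collapse w)) (collapse-∉Z (comp-∉Z u∈)) (Comp-collapse w∈H u∈)

      K-cliqueOrTree : CliqueOrTreeComps K
      K-cliqueOrTree w _ with collapse w ∈? V H
      ... | no w∉H = inj₂ λ where
        [] ()
        (_ ∷ _) cyc (x∈ ∷ _) → w∉H (proj₁ (cycle-Comp cyc (here refl) x∈))
      ... | yes w∈H with cliqueOrTree (collapse w) w∈H
      ...   | inj₂ tree = inj₂ λ c cyc inComp → tree c (cycle-K⇒H cyc) (cycle-Comps cyc inComp)
      ...   | inj₁ clique with Touches-v₁? w
      ...     | yes touches  = inj₂ (clique-at-v₁⇒tree clique (Touches-v₁⇒Comp {w} w∈H touches))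
      ...     | no untouched = inj₁ (clique-off-v₁⇒clique w∈H clique untouched)

      K-simple : Simple K
      K-simple = loopless , ≤1
        where
        loopless : ∀ u → mult K u u ≡ 0
        loopless u with u ∈? Z
        ... | yes u∈Z = n≤0⇒n≡0 (≤-trans (mult-≤ K≤G u u) (≤-reflexive (Z-loopless u∈Z)))
        ... | no u∉Z  = trans (sym (mult-H≡K u∉Z u∉Z)) (proj₁ simple u)
        ≤1 : ∀ a b → mult K a b ≤ 1
        ≤1 a b with a ∈? Z | b ∈? Z
        ... | yes a∈Z | _       = ≤-trans (mult-≤ K≤G a b) (Z-mult≤1 a∈Z b)
        ... | no _    | yes b∈Z =
          subst (_≤ 1) (mult-sym K b a) (≤-trans (mult-≤ K≤G b a) (Z-mult≤1 b∈Z a))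
        ... | no a∉Z  | no b∉Z  = subst (_≤ 1) (mult-H≡K a∉Z b∉Z) (proj₂ simple a b)

    YesInstance-restore : ∀ k → YesInstance (G ∖ Z) k → YesInstance G k
    YesInstance-restore k (S , S⊆V , ∣S∣≤k , simple , cliqueOrTree) =
      S , proj₁ ∘ ∈V-∖ {G = G} ∘ S⊆V , ∣S∣≤k , K-simple , K-cliqueOrTree
      where open Restore S simple cliqueOrTree

lemma14 : {n : ℕ} (G : Multigraph n) (k ℓ : ℕ) (v : ℕ → Fin n)
    → IsPath G ℓ v
    → 2 < deg G (v 0)
    → deg G (v (ℓ ∸ 1)) ≡ 1
    → (∀ i → 1 ≤ i → i < ℓ ∸ 1 → deg G (v i) ≡ 2)
    → (Z : Subset n)
    → (∀ u → u ∈ Z ⇔ Σ ℕ (λ i → 2 ≤ i × i < ℓ × v i ≡ u))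
    → YesInstance G k ⇔ YesInstance (G ∖ Z) k
lemma14 G k ℓ v path deg-v₀ deg-end deg-inner Z Z-spec =
  mk⇔ (YesInstance-∖ G Z k) (YesInstance-restore k)
  where open PendantPath G ℓ v path deg-v₀ deg-end deg-inner using (module Tail)
        open Tail Z Z-spec using (YesInstance-restore)
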